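{- Let $\alpha, \beta$ be integers with $\alpha \geq 1$ and $0 \leq \beta < \alpha$, and let $(a_n)_{n\geq 1}$ be a sequence of complex numbers. For $|q|<1$, \[ \sum_{n=1}^{\infty} a_n \frac{q^{\alpha n-\beta}}{1-q^{\alpha n-\beta}} = \frac{1}{(q^{\alpha-\beta};q^\alpha)_\infty} \sum_{n=1}^{\infty} \left( \sum_{k=1}^n (s_o(n,k)-s_e(n,k))\, a_k\right) q^n, \] where $s_o(n,k)$ (respectively $s_e(n,k)$) denotes the number of $(\alpha k-\beta)$'s in all partitions of $n$ into an odd (respectively even) number of distinct parts of the form $\alpha j-\beta$, $j \geq 1$.
   Context: For complex $a$ and $|q|<1$, $(a;q)_\infty := \prod_{j \geq 0} (1 - a q^j)$; thus $(q^{\alpha-\beta};q^\alpha)_\infty = \prod_{j \geq 1}(1-q^{\alpha j-\beta})$. "The number of $(\alpha k-\beta)$'s in all partitions" means the total number of occurrences of the part $\alpha k-\beta$ over all such partitions. -}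

module Defs where

open import Level using (Level)
open import Data.Nat using (ℕ; zero; suc)
import Data.Nat as N
import Data.Nat.Divisibility
open import Data.Nat.ListAction using (sum)
open import Data.Bool using (Bool; true; false; if_then_else_; _∧_; not)
open import Data.List using (List; []; _∷_; map; filter; length; zipWith; foldr)
open import Data.Nat.Properties using (_≟_)
open import Relation.Nullary.Decidable using (does)
open import Algebra.Bundles using (CommutativeRing)

range1 : ℕ → List ℕ
range1 zero    = []
range1 (suc n) = go 1 n
  where
  go : ℕ → ℕ → List ℕ
  go i zero    = i ∷ []
  go i (suc k) = i ∷ go (suc i) k

sublists : List ℕ → List (List ℕ)
sublists []       = [] ∷ []
sublists (x ∷ xs) = let r = sublists xs in map (x ∷_) r Data.List.++ r

-- Since α ≥ 1 and 0 ≤ β < α we have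
-- α j - β ≥ j, so only j ∈ {1,…,n} can occur, and distinct j give
-- distinct parts.
distinctPartitions : (α β n : ℕ) → List (List ℕ)
distinctPartitions α β n =
  filter (λ p → sum p ≟ n)
         (map (map (λ j → α N.* j N.∸ β)) (sublists (range1 n)))

occ : ℕ → List ℕ → ℕ
occ m []       = 0
occ m (x ∷ xs) = (if does (m ≟ x) then 1 else 0) N.+ occ m xs

isOdd : ℕ → Bool
isOdd n = does (n N.% 2 ≟ 1)

s-o : (α β n k : ℕ) → ℕ
s-o α β n k =
  sum (map (occ (α N.* k N.∸ β))
           (filter (λ p → isOdd (length p) Data.Bool.≟ true) (distinctPartitions α β n)))

s-e : (α β n k : ℕ) → ℕ
s-e α β n k =
  sum (map (occ (α N.* k N.∸ β))
           (filter (λ p → isOdd (length p) Data.Bool.≟ false) (distinctPartitions α β n)))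

module Series {c ℓ : Level} (R : CommutativeRing c ℓ) where
  open CommutativeRing R

  PS : Set c
  PS = ℕ → Carrier

  sumFromTo : ℕ → ℕ → (ℕ → Carrier) → Carrier
  sumFromTo lo hi f = foldr (λ i acc → f i + acc) 0#
                            (filter (λ i → lo N.≤? i) (0 ∷ range1 hi))

  fromℕ : ℕ → Carrier
  fromℕ zero    = 0#
  fromℕ (suc n) = 1# + fromℕ n

  mulPS : PS → PS → PS
  mulPS f g N = sumFromTo 0 N (λ i → f i * g (N N.∸ i))

  -- multiplicative inverse of a power series with constant term 1:
  -- b 0 = 1,  b (n+1) = - Σ_{i=1}^{n+1} f i * b (n+1-i)
  private
    invAux : PS → ℕ → List Carrier   -- [b n, b (n-1), …, b 0]
    invAux f zero    = 1# ∷ []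
    invAux f (suc n) =
      let prev = invAux f n in
      (- foldr _+_ 0# (zipWith _*_ (map f (range1 (suc n))) prev)) ∷ prev

  invPS : PS → PS
  invPS f n with invAux f n
  ... | []    = 0#
  ... | x ∷ _ = x

  oneMinusQPow : ℕ → PS → PS
  oneMinusQPow m f N = f N - (if m N.≤ᵇ N then f (N N.∸ m) else 0#)

  finProd : (α β M : ℕ) → PS
  finProd α β zero    N = if N N.≡ᵇ 0 then 1# else 0#
  finProd α β (suc M) = oneMinusQPow (α N.* suc M N.∸ β) (finProd α β M)

  -- (q^(α-β); q^α)_∞ = ∏_{j ≥ 1} (1 - q^(α j - β)); its N-th coefficient
  -- equals that of the finite product up to j = N (later factors are
  -- 1 + O(q^(N+1)) since α j - β ≥ j).
  qPochhammer : (α β : ℕ) → PS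
  qPochhammer α β N = finProd α β N N

  -- q^m / (1 - q^m) = Σ_{r ≥ 1} q^(r m)   (for m ≥ 1)
  geomPS : ℕ → PS
  geomPS m zero    = 0#
  geomPS m (suc N) = if does (m Data.Nat.Divisibility.∣? suc N) then 1# else 0#

  -- Σ_{n ≥ 1} a n * q^(α n - β) / (1 - q^(α n - β)); the N-th coefficient
  -- only receives contributions from n ≤ N (as α n - β ≥ n).
  lhsPS : (α β : ℕ) → (ℕ → Carrier) → PS
  lhsPS α β a N = sumFromTo 1 N (λ n → a n * geomPS (α N.* n N.∸ β) N)

  rhsSeries : (α β : ℕ) → (ℕ → Carrier) → PS
  rhsSeries α β a zero    = 0#
  rhsSeries α β a (suc n) =
    sumFromTo 1 (suc n) (λ k → (fromℕ (s-o α β (suc n) k) - fromℕ (s-e α β (suc n) k)) * a k)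

{-# OPTIONS --safe #-}
-- Write x j = α j − β, P_M = ∏_{j ≤ M} (1 − q^{x j}) and G_k = q^{x k} / (1 − q^{x k}).
-- Expanding the product over the subsets S of {1, …, M},
--   P_M G_k = q^{x k} ∏_{j ≤ M, j ≠ k} (1 − q^{x j}) = Σ_{S ∋ k} (−1)^{|S|−1} q^{Σ_{j ∈ S} x j},
-- so for k ≤ n the coefficient of q^n in P_n G_k is s_o(n,k) − s_e(n,k).  Since x j ≥ j, the
-- coefficients of q^n in P_n and in (q^{α−β}; q^α)_∞ agree, as do those of Σ_{k ≤ n} a_k G_k and
-- the left-hand side.  Hence (q^{α−β}; q^α)_∞ · LHS = Σ_n (Σ_k (s_o − s_e) a_k) q^n, and the
-- theorem follows by multiplying with the inverse of the product, whose constant term is 1.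
module Submission where

open import Defs
open import Algebra.Bundles using (CommutativeRing)
import Algebra.Properties.CommutativeSemigroup as CommutativeSemigroupProperties
import Algebra.Properties.Ring as RingProperties
open import Data.Bool using (Bool; true; false; if_then_else_)
import Data.Bool as Bool
open import Data.Empty using (⊥-elim)
open import Data.List
  using (List; []; _∷_; _∷ʳ_; _++_; map; filter; foldr; zipWith; length; reverse; applyUpTo; applyDownFrom)
import Data.List.Properties as Listₚ
open import Data.List.Relation.Unary.All as All using (All; []; _∷_)
import Data.List.Relation.Unary.All.Properties as Allₚ
open import Data.List.Relation.Binary.Permutation.Propositional as ↭ using (_↭_; ↭-sym)
open import Data.List.Relation.Binary.Permutation.Propositional.Properties using (↭-length; ∷↭∷ʳ)
open import Data.Nat as ℕ using (ℕ; zero; suc; _≤_; _<_; _∸_; z≤n; s≤s; z<s)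
open import Data.Nat.DivMod using ([m+n]%n≡m%n)
open import Data.Nat.Divisibility using (_∣_; _∣?_; ∣⇒≤; ∣-refl; ∣m∣n⇒∣m+n; ∣m+n∣m⇒∣n)
open import Data.Nat.ListAction using (sum)
open import Data.Nat.ListAction.Properties using (sum-↭)
import Data.Nat.Properties as ℕₚ
open import Data.Sum using (inj₁; inj₂)
open import Data.Unit using (tt)
open import Function using (_∘_)
open import Function.Bundles using (mk⇔)
open import Level using (Level)
open import Relation.Binary.PropositionalEquality as ≡ using (_≡_; _≢_)
import Relation.Binary.Reasoning.Setoid as SetoidReasoning
open import Relation.Nullary using (Dec; yes; no; does)
open import Relation.Nullary.Decidable using (dec-true; dec-false; does-⇔)

private
  mutual
    -- `range1` counts up with a local helper that cannot be named; `countUp` is solved for it by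
    -- unification, which is a pattern problem once `suc n` and `2` are abstracted.
    countUp : ℕ → ℕ → ℕ → List ℕ
    countUp = _

    range1-unfold : ∀ n → range1 (suc (suc n)) ≡ 1 ∷ countUp (suc n) 2 n
    range1-unfold n with suc n | 2
    ... | _ | _ = ≡.refl

  countUp-applyUpTo : ∀ m i k (f : ℕ → ℕ) → (∀ j → f j ≡ i ℕ.+ j) →
                      countUp m i k ≡ applyUpTo f (suc k)
  countUp-applyUpTo m i zero    f f≗ = ≡.cong (_∷ []) (≡.trans (≡.sym (ℕₚ.+-identityʳ i)) (≡.sym (f≗ 0)))
  countUp-applyUpTo m i (suc k) f f≗ =
    ≡.cong₂ _∷_ (≡.trans (≡.sym (ℕₚ.+-identityʳ i)) (≡.sym (f≗ 0)))
                (countUp-applyUpTo m (suc i) k (f ∘ suc) (λ j → ≡.trans (f≗ (suc j)) (ℕₚ.+-suc i j)))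

range1-applyUpTo : ∀ n → range1 n ≡ applyUpTo suc n
range1-applyUpTo zero          = ≡.refl
range1-applyUpTo (suc zero)    = ≡.refl
range1-applyUpTo (suc (suc n)) =
  ≡.trans (range1-unfold n) (≡.cong (1 ∷_) (countUp-applyUpTo (suc n) 2 n (suc ∘ suc) (λ _ → ≡.refl)))

sublists-map : ∀ (f : ℕ → ℕ) xs → sublists (map f xs) ≡ map (map f) (sublists xs)
sublists-map f []       = ≡.refl
sublists-map f (x ∷ xs) = begin
  map (f x ∷_) (sublists (map f xs)) ++ sublists (map f xs)
    ≡⟨ ≡.cong (λ r → map (f x ∷_) r ++ r) (sublists-map f xs) ⟩
  map (f x ∷_) (map (map f) S) ++ map (map f) S
    ≡⟨ ≡.cong (_++ map (map f) S) (≡.trans (≡.sym (Listₚ.map-∘ S)) (Listₚ.map-∘ S)) ⟩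
  map (map f) (map (x ∷_) S) ++ map (map f) S
    ≡⟨ Listₚ.map-++ (map f) (map (x ∷_) S) S ⟨
  map (map f) (map (x ∷_) S ++ S) ∎
  where
  open ≡.≡-Reasoning
  S = sublists xs

isOdd-+2 : ∀ n → isOdd (suc (suc n)) ≡ isOdd n
isOdd-+2 n = ≡.cong (λ r → does (r ℕ.≟ 1))
                    (≡.trans (≡.cong (ℕ._% 2) (ℕₚ.+-comm 2 n)) ([m+n]%n≡m%n n 2))

isOdd-suc : ∀ n → isOdd (suc n) ≡ Bool.not (isOdd n)
isOdd-suc zero          = ≡.refl
isOdd-suc (suc zero)    = ≡.refl
isOdd-suc (suc (suc n)) =
  ≡.trans (isOdd-+2 (suc n)) (≡.trans (isOdd-suc n) (≡.cong Bool.not (≡.sym (isOdd-+2 n))))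

occ-∷-≡ : ∀ m p → occ m (m ∷ p) ≡ suc (occ m p)
occ-∷-≡ m p = ≡.cong (λ b → (if b then 1 else 0) ℕ.+ occ m p) (dec-true (m ℕ.≟ m) ≡.refl)

occ-∷-≢ : ∀ {m e} → m ≢ e → ∀ p → occ m (e ∷ p) ≡ occ m p
occ-∷-≢ {m} {e} m≢e p = ≡.cong (λ b → (if b then 1 else 0) ℕ.+ occ m p) (dec-false (m ℕ.≟ e) m≢e)

occ-↭ : ∀ m {p p′} → p ↭ p′ → occ m p ≡ occ m p′
occ-↭ m ↭.refl               = ≡.refl
occ-↭ m (↭.prep e p↭p′)      = ≡.cong (_ ℕ.+_) (occ-↭ m p↭p′)
occ-↭ m {_ ∷ _ ∷ p} (↭.swap e e′ p↭p′) =
  ≡.trans (x∙yz≈y∙xz (ind e) (ind e′) (occ m p))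
          (≡.cong (λ o → ind e′ ℕ.+ (ind e ℕ.+ o)) (occ-↭ m p↭p′))
  where
  open CommutativeSemigroupProperties ℕₚ.+-commutativeSemigroup using (x∙yz≈y∙xz)
  ind : ℕ → ℕ
  ind x = if does (m ℕ.≟ x) then 1 else 0
occ-↭ m (↭.trans p↭p″ p″↭p′) = ≡.trans (occ-↭ m p↭p″) (occ-↭ m p″↭p′)

sublists-avoid : ∀ {m} es → occ m es ≡ 0 → All (λ p → occ m p ≡ 0) (sublists es)
sublists-avoid []           _  = ≡.refl ∷ []
sublists-avoid {m} (e ∷ es) m∉ =
  Allₚ.++⁺ (Allₚ.map⁺ (All.map (λ {p} → ≡.trans (occ-∷-≢ m≢e p)) avoid)) avoid
  where
  avoid = sublists-avoid es (ℕₚ.m+n≡0⇒n≡0 _ m∉)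
  m≢e : m ≢ e
  m≢e ≡.refl = ℕₚ.0≢1+n (≡.trans (≡.sym m∉) (occ-∷-≡ m es))

part : ℕ → ℕ → ℕ → ℕ
part α β j = α ℕ.* j ∸ β

-- part M, …, part 1: the exponents of the factors of `finProd α β M`, outermost first.
parts : ℕ → ℕ → ℕ → List ℕ
parts α β M = map (part α β) (applyDownFrom suc M)

j≤part : ∀ {α β} → β < α → ∀ j → j ≤ part α β j
j≤part β<α zero = z≤n
j≤part {α@(suc _)} {β} β<α (suc j) =
  ≡.subst (suc j ≤_) (≡.sym part≡) (ℕₚ.+-mono-≤ (ℕₚ.m<n⇒0<n∸m β<α) (ℕₚ.m≤n*m j α))
  where
  part≡ : part α β (suc j) ≡ (α ∸ β) ℕ.+ α ℕ.* j
  part≡ = ≡.trans (≡.cong (_∸ β) (ℕₚ.*-suc α j)) (ℕₚ.+-∸-comm (α ℕ.* j) (ℕₚ.<⇒≤ β<α))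

part-injective : ∀ {α β} → β < α → ∀ {j k} → 1 ≤ j → 1 ≤ k → part α β j ≡ part α β k → j ≡ k
part-injective {α@(suc _)} {β} β<α {j} {k} 1≤j 1≤k eq =
  ℕₚ.*-cancelˡ-≡ j k α
    (≡.trans (≡.sym (ℕₚ.m∸n+n≡m (β≤α* 1≤j)))
             (≡.trans (≡.cong (ℕ._+ β) eq) (ℕₚ.m∸n+n≡m (β≤α* 1≤k))))
  where
  β≤α* : ∀ {i} → 1 ≤ i → β ≤ α ℕ.* i
  β≤α* {suc i} _ = ℕₚ.≤-trans (ℕₚ.<⇒≤ β<α) (ℕₚ.m≤m*n α (suc i))

map-part-range1 : ∀ α β n → map (part α β) (range1 n) ≡ reverse (parts α β n)
map-part-range1 α β n =
  ≡.trans (≡.cong (map (part α β)) (≡.trans (range1-applyUpTo n) (≡.sym (Listₚ.reverse-applyDownFrom suc n))))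
          (Listₚ.reverse-map (part α β) (applyDownFrom suc n))

occ-parts-absent : ∀ {α β} → β < α → ∀ {k} M → M < k → occ (part α β k) (parts α β M) ≡ 0
occ-parts-absent β<α zero _ = ≡.refl
occ-parts-absent {α} {β} β<α (suc M) M<k =
  ≡.trans (occ-∷-≢ (λ eq → ℕₚ.<-irrefl (≡.sym (part-injective β<α 1≤k z<s eq)) M<k) (parts α β M))
          (occ-parts-absent β<α M (ℕₚ.<-trans (ℕₚ.n<1+n M) M<k))
  where 1≤k = ℕₚ.≤-trans (s≤s z≤n) M<k

occ-parts-once : ∀ {α β} → β < α → ∀ {k} M → 1 ≤ k → k ≤ M → occ (part α β k) (parts α β M) ≡ 1
occ-parts-once β<α zero 1≤k k≤0 = ⊥-elim (ℕₚ.<⇒≱ 1≤k k≤0)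
occ-parts-once {α} {β} β<α {k} (suc M) 1≤k k≤M with k ℕ.≟ suc M
... | yes ≡.refl =
  ≡.trans (occ-∷-≡ (part α β k) (parts α β M)) (≡.cong suc (occ-parts-absent β<α M (ℕₚ.n<1+n M)))
... | no k≢M =
  ≡.trans (occ-∷-≢ (λ eq → k≢M (part-injective β<α 1≤k z<s eq)) (parts α β M))
          (occ-parts-once β<α M 1≤k (ℕₚ.≤-pred (ℕₚ.≤∧≢⇒< k≤M k≢M)))

module PowerSeries {c ℓ : Level} (R : CommutativeRing c ℓ) where

  open CommutativeRing R
  open Series R
  open RingProperties ring using (-0#≈0#; -‿+-comm; -‿involutive; -‿distribˡ-*; [y-z]x≈yx-zx; -1*x≈-x)
  open CommutativeSemigroupProperties +-commutativeSemigroup using (interchange)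
  open CommutativeSemigroupProperties *-commutativeSemigroup using (x∙yz≈y∙xz)
  open SetoidReasoning setoid

  ∑ : ℕ → (ℕ → Carrier) → Carrier
  ∑ zero    f = 0#
  ∑ (suc n) f = ∑ n f + f n

  ∑-syntax : ℕ → (ℕ → Carrier) → Carrier
  ∑-syntax = ∑

  infix 5 ∑-syntax
  syntax ∑-syntax n (λ i → e) = ∑[ i < n ] e

  ∑-cong : ∀ n {f g : ℕ → Carrier} → (∀ i → i < n → f i ≈ g i) → ∑ n f ≈ ∑ n g
  ∑-cong zero    f≈g = refl
  ∑-cong (suc n) f≈g = +-cong (∑-cong n (λ i i<n → f≈g i (ℕₚ.m<n⇒m<1+n i<n))) (f≈g n ℕₚ.≤-refl)

  ∑-zero : ∀ n {f : ℕ → Carrier} → (∀ i → i < n → f i ≈ 0#) → ∑ n f ≈ 0#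
  ∑-zero zero    f≈0 = refl
  ∑-zero (suc n) f≈0 =
    trans (+-cong (∑-zero n (λ i i<n → f≈0 i (ℕₚ.m<n⇒m<1+n i<n))) (f≈0 n ℕₚ.≤-refl)) (+-identityʳ 0#)

  ∑-+ : ∀ n (f g : ℕ → Carrier) → ∑[ i < n ] (f i + g i) ≈ ∑ n f + ∑ n g
  ∑-+ zero    f g = sym (+-identityʳ 0#)
  ∑-+ (suc n) f g = trans (+-congʳ (∑-+ n f g)) (interchange _ _ _ _)

  ∑-neg : ∀ n (f : ℕ → Carrier) → - ∑ n f ≈ ∑[ i < n ] - f i
  ∑-neg zero    f = -0#≈0#
  ∑-neg (suc n) f = trans (sym (-‿+-comm _ _)) (+-congʳ (∑-neg n f))

  ∑-*ˡ : ∀ n x (f : ℕ → Carrier) → x * ∑ n f ≈ ∑[ i < n ] x * f i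
  ∑-*ˡ zero    x f = zeroʳ x
  ∑-*ˡ (suc n) x f = trans (distribˡ x _ _) (+-congʳ (∑-*ˡ n x f))

  ∑-*ʳ : ∀ n x (f : ℕ → Carrier) → ∑ n f * x ≈ ∑[ i < n ] f i * x
  ∑-*ʳ n x f = trans (*-comm _ x) (trans (∑-*ˡ n x f) (∑-cong n (λ i _ → *-comm x (f i))))

  ∑-swap : ∀ m n (F : ℕ → ℕ → Carrier) → ∑[ i < m ] ∑[ j < n ] F i j ≈ ∑[ j < n ] ∑[ i < m ] F i j
  ∑-swap zero    n F = sym (∑-zero n (λ _ _ → refl))
  ∑-swap (suc m) n F = trans (+-congʳ (∑-swap m n F)) (sym (∑-+ n _ _))

  ∑-head : ∀ n (f : ℕ → Carrier) → ∑ (suc n) f ≈ f 0 + (∑[ i < n ] f (suc i))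
  ∑-head zero    f = trans (+-identityˡ _) (sym (+-identityʳ _))
  ∑-head (suc n) f = trans (+-congʳ (∑-head n f)) (+-assoc _ _ _)

  ∑-reverse : ∀ n (f : ℕ → Carrier) → ∑ n f ≈ ∑[ i < n ] f (n ∸ suc i)
  ∑-reverse zero    f = refl
  ∑-reverse (suc n) f = begin
    ∑ n f + f n                          ≈⟨ +-congʳ (∑-reverse n f) ⟩
    (∑[ i < n ] f (n ∸ suc i)) + f n     ≈⟨ +-comm _ _ ⟩
    f n + (∑[ i < n ] f (n ∸ suc i))     ≈⟨ ∑-head n (λ i → f (suc n ∸ suc i)) ⟨
    ∑[ i < suc n ] f (suc n ∸ suc i)     ∎

  ∑-triangle : ∀ n (F : ℕ → ℕ → Carrier) →
               ∑[ i < suc n ] ∑[ j < suc i ] F i j ≈ ∑[ j < suc n ] ∑[ k < suc (n ∸ j) ] F (j ℕ.+ k) j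
  ∑-triangle zero    F = refl
  ∑-triangle (suc n) F = begin
    (∑[ i < suc n ] ∑[ j < suc i ] F i j) + (∑ (suc n) (F (suc n)) + F (suc n) (suc n))
      ≈⟨ +-congʳ (∑-triangle n F) ⟩
    (∑[ j < suc n ] column j (n ∸ j)) + (∑ (suc n) (F (suc n)) + F (suc n) (suc n))
      ≈⟨ +-assoc _ _ _ ⟨
    (∑[ j < suc n ] column j (n ∸ j)) + ∑ (suc n) (F (suc n)) + F (suc n) (suc n)
      ≈⟨ +-cong (∑-+ (suc n) _ _) (+-identityˡ _) ⟨
    (∑[ j < suc n ] column j (n ∸ j) + F (suc n) j) + (0# + F (suc n) (suc n))
      ≈⟨ +-cong (∑-cong (suc n) (λ j j<n → extend (ℕₚ.≤-pred j<n))) last ⟩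
    (∑[ j < suc n ] column j (suc n ∸ j)) + column (suc n) (suc n ∸ suc n)
      ∎
    where
    column : ℕ → ℕ → Carrier
    column j m = ∑[ k < suc m ] F (j ℕ.+ k) j
    extend : ∀ {j} → j ≤ n → column j (n ∸ j) + F (suc n) j ≈ column j (suc n ∸ j)
    extend {j} j≤n rewrite ℕₚ.+-∸-assoc 1 j≤n = +-congˡ (reflexive (≡.cong (λ i → F i j) (≡.sym
      (≡.trans (ℕₚ.+-suc j (n ∸ j)) (≡.cong suc (ℕₚ.m+[n∸m]≡n j≤n))))))
    last : 0# + F (suc n) (suc n) ≈ column (suc n) (suc n ∸ suc n)
    last rewrite ℕₚ.n∸n≡0 n | ℕₚ.+-identityʳ n = refl

  ∑-pad : ∀ m k (f : ℕ → Carrier) → (∀ i → m ≤ i → f i ≈ 0#) → ∑ (m ℕ.+ k) f ≈ ∑ m f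
  ∑-pad m zero    f f≈0 = reflexive (≡.cong (λ n → ∑ n f) (ℕₚ.+-identityʳ m))
  ∑-pad m (suc k) f f≈0 = begin
    ∑ (m ℕ.+ suc k) f             ≡⟨ ≡.cong (λ n → ∑ n f) (ℕₚ.+-suc m k) ⟩
    ∑ (m ℕ.+ k) f + f (m ℕ.+ k)   ≈⟨ +-cong (∑-pad m k f f≈0) (f≈0 (m ℕ.+ k) (ℕₚ.m≤m+n m k)) ⟩
    ∑ m f + 0#                    ≈⟨ +-identityʳ _ ⟩
    ∑ m f                         ∎

  ∑ˡ : {A : Set} → List A → (A → Carrier) → Carrier
  ∑ˡ xs f = foldr (λ x → f x +_) 0# xs

  infix 5 ∑ˡ
  syntax ∑ˡ xs (λ x → e) = ∑[ x ∈ xs ] e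

  module _ {A : Set} where

    ∑ˡ-cong : ∀ (xs : List A) {f g : A → Carrier} → (∀ x → f x ≈ g x) → ∑ˡ xs f ≈ ∑ˡ xs g
    ∑ˡ-cong []       f≈g = refl
    ∑ˡ-cong (x ∷ xs) f≈g = +-cong (f≈g x) (∑ˡ-cong xs f≈g)

    ∑ˡ-cong-All : ∀ {xs : List A} {f g : A → Carrier} → All (λ x → f x ≈ g x) xs → ∑ˡ xs f ≈ ∑ˡ xs g
    ∑ˡ-cong-All []          = refl
    ∑ˡ-cong-All (fx≈gx ∷ h) = +-cong fx≈gx (∑ˡ-cong-All h)

    ∑ˡ-0# : ∀ (xs : List A) → ∑[ x ∈ xs ] 0# ≈ 0#
    ∑ˡ-0# []       = refl
    ∑ˡ-0# (x ∷ xs) = trans (+-congˡ (∑ˡ-0# xs)) (+-identityʳ 0#)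

    ∑ˡ-+ : ∀ (xs : List A) f g → ∑[ x ∈ xs ] (f x + g x) ≈ ∑ˡ xs f + ∑ˡ xs g
    ∑ˡ-+ []       f g = sym (+-identityʳ 0#)
    ∑ˡ-+ (x ∷ xs) f g = trans (+-congˡ (∑ˡ-+ xs f g)) (interchange _ _ _ _)

    ∑ˡ-neg : ∀ (xs : List A) f → - ∑ˡ xs f ≈ ∑[ x ∈ xs ] - f x
    ∑ˡ-neg []       f = -0#≈0#
    ∑ˡ-neg (x ∷ xs) f = trans (sym (-‿+-comm _ _)) (+-congˡ (∑ˡ-neg xs f))

    ∑ˡ-++ : ∀ (xs ys : List A) f → ∑ˡ (xs ++ ys) f ≈ ∑ˡ xs f + ∑ˡ ys f
    ∑ˡ-++ []       ys f = sym (+-identityˡ _)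
    ∑ˡ-++ (x ∷ xs) ys f = trans (+-congˡ (∑ˡ-++ xs ys f)) (sym (+-assoc _ _ _))

    ∑ˡ-map : ∀ {B : Set} (h : B → A) (xs : List B) f → ∑ˡ (map h xs) f ≡ ∑[ x ∈ xs ] f (h x)
    ∑ˡ-map h []       f = ≡.refl
    ∑ˡ-map h (x ∷ xs) f = ≡.cong (f (h x) +_) (∑ˡ-map h xs f)

    ∑ˡ-filter : ∀ {P : A → Set} (P? : ∀ x → Dec (P x)) xs f →
                ∑ˡ (filter P? xs) f ≈ ∑[ x ∈ xs ] (if does (P? x) then f x else 0#)
    ∑ˡ-filter P? []       f = refl
    ∑ˡ-filter P? (x ∷ xs) f with does (P? x)
    ... | true  = +-congˡ (∑ˡ-filter P? xs f)
    ... | false = trans (∑ˡ-filter P? xs f) (sym (+-identityˡ _))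

  ∑ˡ-applyUpTo : ∀ (u : ℕ → ℕ) n f → ∑ˡ (applyUpTo u n) f ≈ ∑[ i < n ] f (u i)
  ∑ˡ-applyUpTo u zero    f = refl
  ∑ˡ-applyUpTo u (suc n) f = trans (+-congˡ (∑ˡ-applyUpTo (u ∘ suc) n f)) (sym (∑-head n (f ∘ u)))

  fromℕ-+ : ∀ m n → fromℕ (m ℕ.+ n) ≈ fromℕ m + fromℕ n
  fromℕ-+ zero    n = sym (+-identityˡ _)
  fromℕ-+ (suc m) n = trans (+-congˡ (fromℕ-+ m n)) (sym (+-assoc _ _ _))

  fromℕ-sum : ∀ {A : Set} (f : A → ℕ) xs → fromℕ (sum (map f xs)) ≈ ∑[ x ∈ xs ] fromℕ (f x)
  fromℕ-sum f []       = refl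
  fromℕ-sum f (x ∷ xs) = trans (fromℕ-+ (f x) _) (+-congˡ (fromℕ-sum f xs))

  sumFromTo-0 : ∀ n f → sumFromTo 0 n f ≈ ∑ (suc n) f
  sumFromTo-0 n f = begin
    ∑ˡ (filter (0 ℕ.≤?_) (0 ∷ range1 n)) f
      ≡⟨ ≡.cong (λ xs → ∑ˡ xs f) (Listₚ.filter-all (0 ℕ.≤?_) (All.universal (λ _ → z≤n) (0 ∷ range1 n))) ⟩
    f 0 + ∑ˡ (range1 n) f
      ≡⟨ ≡.cong (λ xs → f 0 + ∑ˡ xs f) (range1-applyUpTo n) ⟩
    f 0 + ∑ˡ (applyUpTo suc n) f
      ≈⟨ +-congˡ (∑ˡ-applyUpTo suc n f) ⟩
    f 0 + (∑[ i < n ] f (suc i))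
      ≈⟨ ∑-head n f ⟨
    ∑ (suc n) f
      ∎

  sumFromTo-1 : ∀ n f → sumFromTo 1 n f ≈ ∑[ i < n ] f (suc i)
  sumFromTo-1 n f = begin
    ∑ˡ (filter (1 ℕ.≤?_) (range1 n)) f
      ≡⟨ ≡.cong (λ xs → ∑ˡ (filter (1 ℕ.≤?_) xs) f) (range1-applyUpTo n) ⟩
    ∑ˡ (filter (1 ℕ.≤?_) (applyUpTo suc n)) f
      ≡⟨ ≡.cong (λ xs → ∑ˡ xs f) (Listₚ.filter-all (1 ℕ.≤?_) (Allₚ.applyUpTo⁺₂ suc n (λ _ → s≤s z≤n))) ⟩
    ∑ˡ (applyUpTo suc n) f
      ≈⟨ ∑ˡ-applyUpTo suc n f ⟩
    ∑[ i < n ] f (suc i)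
      ∎

  -- Multiplication by q^e; note that `oneMinusQPow e f n` unfolds to `f n - shift e f n`.
  shift : ℕ → PS → PS
  shift e f n = if e ℕ.≤ᵇ n then f (n ∸ e) else 0#

  monomial : ℕ → Carrier → PS
  monomial s a n = if does (s ℕ.≟ n) then a else 0#

  one : PS
  one = monomial 0 1#

  shift-≤ : ∀ {e n} (f : PS) → e ≤ n → shift e f n ≡ f (n ∸ e)
  shift-≤ {e} {n} f e≤n with e ℕ.≤ᵇ n | ℕₚ.≤⇒≤ᵇ e≤n
  ... | true | _ = ≡.refl

  shift-< : ∀ {e n} (f : PS) → n < e → shift e f n ≡ 0#
  shift-< {e} {n} f n<e with e ℕ.≤ᵇ n | ℕₚ.≤ᵇ⇒≤ e n
  ... | false | _   = ≡.refl
  ... | true  | e≤n = ⊥-elim (ℕₚ.<⇒≱ n<e (e≤n tt))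

  shift-suc : ∀ e f n → shift (suc e) f n ≡ shift 1 (shift e f) n
  shift-suc e       f zero    = ≡.refl
  shift-suc zero    f (suc n) = ≡.refl
  shift-suc (suc e) f (suc n) = ≡.refl

  shift-cong : ∀ e {f g : PS} n → (∀ i → f i ≈ g i) → shift e f n ≈ shift e g n
  shift-cong e n f≈g with e ℕ.≤ᵇ n
  ... | true  = f≈g _
  ... | false = refl

  shift-neg : ∀ e (f : PS) n → shift e (λ i → - f i) n ≈ - shift e f n
  shift-neg e f n with e ℕ.≤ᵇ n
  ... | true  = refl
  ... | false = sym -0#≈0#

  ∑ˡ-shift : ∀ {A : Set} (xs : List A) e (F : A → PS) n →
             ∑[ x ∈ xs ] shift e (F x) n ≈ shift e (λ i → ∑[ x ∈ xs ] F x i) n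
  ∑ˡ-shift xs e F n with e ℕ.≤ᵇ n
  ... | true  = refl
  ... | false = ∑ˡ-0# xs

  oneMinusQPow-cong : ∀ e {f g : PS} n → (∀ i → f i ≈ g i) → oneMinusQPow e f n ≈ oneMinusQPow e g n
  oneMinusQPow-cong e n f≈g = +-cong (f≈g n) (-‿cong (shift-cong e n f≈g))

  oneMinusQPow-below : ∀ e (f : PS) {n} → n < e → oneMinusQPow e f n ≈ f n
  oneMinusQPow-below e f n<e =
    trans (+-congˡ (trans (-‿cong (reflexive (shift-< f n<e))) -0#≈0#)) (+-identityʳ _)

  monomial-cong : ∀ s {a b} n → a ≈ b → monomial s a n ≈ monomial s b n
  monomial-cong s n a≈b with does (s ℕ.≟ n)
  ... | true  = a≈b
  ... | false = refl

  monomial-zero : ∀ s {a} n → a ≈ 0# → monomial s a n ≈ 0#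
  monomial-zero s n a≈0 with does (s ℕ.≟ n)
  ... | true  = a≈0
  ... | false = refl

  monomial-neg : ∀ s a n → monomial s (- a) n ≈ - monomial s a n
  monomial-neg s a n with does (s ℕ.≟ n)
  ... | true  = refl
  ... | false = sym -0#≈0#

  monomial-shift : ∀ e s a n → monomial (e ℕ.+ s) a n ≈ shift e (monomial s a) n
  monomial-shift e s a n with e ℕ.≤? n
  ... | yes e≤n = reflexive (≡.trans (≡.cong (λ b → if b then a else 0#) same-test)
                                     (≡.sym (shift-≤ (monomial s a) e≤n)))
    where
    same-test : does (e ℕ.+ s ℕ.≟ n) ≡ does (s ℕ.≟ n ∸ e)
    same-test = does-⇔ (mk⇔ (λ eq → ≡.trans (≡.sym (ℕₚ.m+n∸m≡n e s)) (≡.cong (_∸ e) eq))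
                            (λ eq → ≡.trans (≡.cong (e ℕ.+_) eq) (ℕₚ.m+[n∸m]≡n e≤n)))
                       (e ℕ.+ s ℕ.≟ n) (s ℕ.≟ n ∸ e)
  ... | no e≰n = reflexive (≡.trans (≡.cong (λ b → if b then a else 0#) (dec-false (e ℕ.+ s ℕ.≟ n) e+s≢n))
                                    (≡.sym (shift-< (monomial s a) (ℕₚ.≰⇒> e≰n))))
    where
    e+s≢n : e ℕ.+ s ≢ n
    e+s≢n eq = e≰n (ℕₚ.m+n≤o⇒m≤o e (ℕₚ.≤-reflexive eq))

  infixl 7 _⋆_
  _⋆_ : PS → PS → PS
  (f ⋆ g) n = ∑[ i < suc n ] f i * g (n ∸ i)

  mulPS≈⋆ : ∀ f g n → mulPS f g n ≈ (f ⋆ g) n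
  mulPS≈⋆ f g n = sumFromTo-0 n (λ i → f i * g (n ∸ i))

  ⋆-congˡ : ∀ {f f′ : PS} g n → (∀ i → i ≤ n → f i ≈ f′ i) → (f ⋆ g) n ≈ (f′ ⋆ g) n
  ⋆-congˡ g n f≈f′ = ∑-cong (suc n) (λ i i<n → *-congʳ (f≈f′ i (ℕₚ.≤-pred i<n)))

  ⋆-congʳ : ∀ f {g g′ : PS} n → (∀ i → i ≤ n → g i ≈ g′ i) → (f ⋆ g) n ≈ (f ⋆ g′) n
  ⋆-congʳ f n g≈g′ = ∑-cong (suc n) (λ i _ → *-congˡ (g≈g′ (n ∸ i) (ℕₚ.m∸n≤m n i)))

  ⋆-comm : ∀ f g n → (f ⋆ g) n ≈ (g ⋆ f) n
  ⋆-comm f g n = begin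
    ∑[ i < suc n ] f i * g (n ∸ i)                ≈⟨ ∑-reverse (suc n) (λ i → f i * g (n ∸ i)) ⟩
    ∑[ i < suc n ] f (n ∸ i) * g (n ∸ (n ∸ i))    ≈⟨ ∑-cong (suc n) (λ i i<n → trans (*-comm _ _)
                                                       (*-congʳ (reflexive (≡.cong g (ℕₚ.m∸[m∸n]≡n (ℕₚ.≤-pred i<n)))))) ⟩
    ∑[ i < suc n ] g i * f (n ∸ i)                ∎

  ⋆-assoc : ∀ f g h n → ((f ⋆ g) ⋆ h) n ≈ (f ⋆ (g ⋆ h)) n
  ⋆-assoc f g h n = begin
    ∑[ i < suc n ] (∑[ j < suc i ] f j * g (i ∸ j)) * h (n ∸ i)
      ≈⟨ ∑-cong (suc n) (λ i _ → ∑-*ʳ (suc i) (h (n ∸ i)) (λ j → f j * g (i ∸ j))) ⟩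
    ∑[ i < suc n ] ∑[ j < suc i ] f j * g (i ∸ j) * h (n ∸ i)
      ≈⟨ ∑-triangle n (λ i j → f j * g (i ∸ j) * h (n ∸ i)) ⟩
    ∑[ j < suc n ] ∑[ k < suc (n ∸ j) ] f j * g (j ℕ.+ k ∸ j) * h (n ∸ (j ℕ.+ k))
      ≈⟨ ∑-cong (suc n) (λ j _ → ∑-cong (suc (n ∸ j)) (λ k _ → trans (*-assoc _ _ _)
           (*-congˡ (*-cong (reflexive (≡.cong g (ℕₚ.m+n∸m≡n j k)))
                            (reflexive (≡.cong h (≡.sym (ℕₚ.∸-+-assoc n j k)))))))) ⟩
    ∑[ j < suc n ] ∑[ k < suc (n ∸ j) ] f j * (g k * h (n ∸ j ∸ k))
      ≈⟨ ∑-cong (suc n) (λ j _ → ∑-*ˡ (suc (n ∸ j)) (f j) (λ k → g k * h (n ∸ j ∸ k))) ⟨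
    ∑[ j < suc n ] f j * (g ⋆ h) (n ∸ j)
      ∎

  ⋆-identityˡ : ∀ f n → (one ⋆ f) n ≈ f n
  ⋆-identityˡ f n = begin
    (one ⋆ f) n                                      ≈⟨ ∑-head n (λ i → one i * f (n ∸ i)) ⟩
    1# * f n + (∑[ i < n ] 0# * f (n ∸ suc i))       ≈⟨ +-cong (*-identityˡ _) (∑-zero n (λ _ _ → zeroˡ _)) ⟩
    f n + 0#                                         ≈⟨ +-identityʳ _ ⟩
    f n                                              ∎

  ⋆-shift₁ˡ : ∀ f g n → (shift 1 f ⋆ g) n ≈ shift 1 (f ⋆ g) n
  ⋆-shift₁ˡ f g zero    = trans (+-identityˡ _) (zeroˡ _)
  ⋆-shift₁ˡ f g (suc n) = begin
    (shift 1 f ⋆ g) (suc n)                          ≈⟨ ∑-head (suc n) (λ i → shift 1 f i * g (suc n ∸ i)) ⟩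
    0# * g (suc n) + (f ⋆ g) n                       ≈⟨ +-congʳ (zeroˡ _) ⟩
    0# + (f ⋆ g) n                                   ≈⟨ +-identityˡ _ ⟩
    (f ⋆ g) n                                        ∎

  ⋆-shiftˡ : ∀ e f g n → (shift e f ⋆ g) n ≈ shift e (f ⋆ g) n
  ⋆-shiftˡ zero    f g n = refl
  ⋆-shiftˡ (suc e) f g n = begin
    (shift (suc e) f ⋆ g) n       ≈⟨ ⋆-congˡ g n (λ i _ → reflexive (shift-suc e f i)) ⟩
    (shift 1 (shift e f) ⋆ g) n   ≈⟨ ⋆-shift₁ˡ (shift e f) g n ⟩
    shift 1 (shift e f ⋆ g) n     ≈⟨ shift-cong 1 n (⋆-shiftˡ e f g) ⟩
    shift 1 (shift e (f ⋆ g)) n   ≡⟨ shift-suc e (f ⋆ g) n ⟨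
    shift (suc e) (f ⋆ g) n       ∎

  ⋆-oneMinusQPowˡ : ∀ e f g n → (oneMinusQPow e f ⋆ g) n ≈ oneMinusQPow e (f ⋆ g) n
  ⋆-oneMinusQPowˡ e f g n = begin
    ∑[ i < suc n ] (f i - shift e f i) * g (n ∸ i)
      ≈⟨ ∑-cong (suc n) (λ i _ → [y-z]x≈yx-zx (g (n ∸ i)) (f i) (shift e f i)) ⟩
    ∑[ i < suc n ] (f i * g (n ∸ i) - shift e f i * g (n ∸ i))
      ≈⟨ ∑-+ (suc n) (λ i → f i * g (n ∸ i)) (λ i → - (shift e f i * g (n ∸ i))) ⟩
    (f ⋆ g) n + (∑[ i < suc n ] - (shift e f i * g (n ∸ i)))
      ≈⟨ +-congˡ (∑-neg (suc n) (λ i → shift e f i * g (n ∸ i))) ⟨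
    (f ⋆ g) n - (shift e f ⋆ g) n
      ≈⟨ +-congˡ (-‿cong (⋆-shiftˡ e f g n)) ⟩
    (f ⋆ g) n - shift e (f ⋆ g) n
      ∎

  ⋆-∑ʳ : ∀ m f (c : ℕ → Carrier) (g : ℕ → PS) n →
         (f ⋆ (λ i → ∑[ j < m ] c j * g j i)) n ≈ ∑[ j < m ] c j * (f ⋆ g j) n
  ⋆-∑ʳ m f c g n = begin
    ∑[ i < suc n ] f i * (∑[ j < m ] c j * g j (n ∸ i))
      ≈⟨ ∑-cong (suc n) (λ i _ → trans (∑-*ˡ m (f i) _)
                                       (∑-cong m (λ j _ → x∙yz≈y∙xz (f i) (c j) (g j (n ∸ i))))) ⟩
    ∑[ i < suc n ] ∑[ j < m ] c j * (f i * g j (n ∸ i))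
      ≈⟨ ∑-swap (suc n) m (λ i j → c j * (f i * g j (n ∸ i))) ⟩
    ∑[ j < m ] ∑[ i < suc n ] c j * (f i * g j (n ∸ i))
      ≈⟨ ∑-cong m (λ j _ → ∑-*ˡ (suc n) (c j) (λ i → f i * g j (n ∸ i))) ⟨
    ∑[ j < m ] c j * (f ⋆ g j) n
      ∎

  foldr-zipWith : ∀ (u v : ℕ → Carrier) k → foldr _+_ 0# (zipWith _*_ (applyUpTo u k) (applyDownFrom v k))
                                             ≈ ∑[ t < k ] u t * v (k ∸ suc t)
  foldr-zipWith u v zero    = refl
  foldr-zipWith u v (suc k) = begin
    u 0 * v k + foldr _+_ 0# (zipWith _*_ (applyUpTo (u ∘ suc) k) (applyDownFrom v k))
      ≈⟨ +-congˡ (foldr-zipWith (u ∘ suc) v k) ⟩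
    u 0 * v k + (∑[ t < k ] u (suc t) * v (k ∸ suc t))
      ≈⟨ ∑-head k (λ t → u t * v (suc k ∸ suc t)) ⟨
    ∑[ t < suc k ] u t * v (suc k ∸ suc t)
      ∎

  invPS-suc : ∀ f n → invPS f (suc n) ≈ - (∑[ t < suc n ] f (suc t) * invPS f (n ∸ t))
  invPS-suc f = unfold (λ _ → ≡.refl) (λ _ → ≡.refl) ≡.refl
    where
    -- `invPS f n` is the head of the private list `invAux f n`, which `aux` recovers by unification.
    unfold : {aux : ℕ → List Carrier} →
             (∀ n → invPS f (suc n) ≡ - foldr _+_ 0# (zipWith _*_ (map f (range1 (suc n))) (aux n))) →
             (∀ n → aux (suc n) ≡ invPS f (suc n) ∷ aux n) → aux 0 ≡ 1# ∷ [] →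
             ∀ n → invPS f (suc n) ≈ - (∑[ t < suc n ] f (suc t) * invPS f (n ∸ t))
    unfold {aux} invPS≡ aux-suc aux-zero n = begin
      invPS f (suc n)
        ≡⟨ invPS≡ n ⟩
      - foldr _+_ 0# (zipWith _*_ (map f (range1 (suc n))) (aux n))
        ≡⟨ ≡.cong₂ (λ xs ys → - foldr _+_ 0# (zipWith _*_ xs ys)) coefficients (trace n) ⟩
      - foldr _+_ 0# (zipWith _*_ (applyUpTo (f ∘ suc) (suc n)) (applyDownFrom (invPS f) (suc n)))
        ≈⟨ -‿cong (foldr-zipWith (f ∘ suc) (invPS f) (suc n)) ⟩
      - (∑[ t < suc n ] f (suc t) * invPS f (n ∸ t))
        ∎
      where
      trace : ∀ n → aux n ≡ applyDownFrom (invPS f) (suc n)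
      trace zero    = aux-zero
      trace (suc n) = ≡.trans (aux-suc n) (≡.cong (invPS f (suc n) ∷_) (trace n))
      coefficients : map f (range1 (suc n)) ≡ applyUpTo (f ∘ suc) (suc n)
      coefficients = ≡.trans (≡.cong (map f) (range1-applyUpTo (suc n))) (Listₚ.map-applyUpTo suc f (suc n))

  ⋆-invPSʳ : ∀ f → f 0 ≈ 1# → ∀ n → (f ⋆ invPS f) n ≈ one n
  ⋆-invPSʳ f f0≈1 zero    = trans (+-identityˡ _) (trans (*-identityʳ _) f0≈1)
  ⋆-invPSʳ f f0≈1 (suc n) = begin
    (f ⋆ invPS f) (suc n)                   ≈⟨ ∑-head (suc n) (λ i → f i * invPS f (suc n ∸ i)) ⟩
    f 0 * invPS f (suc n) + S               ≈⟨ +-congʳ (*-cong f0≈1 (invPS-suc f n)) ⟩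
    1# * - S + S                            ≈⟨ +-congʳ (*-identityˡ _) ⟩
    - S + S                                 ≈⟨ -‿inverseˡ S ⟩
    0#                                      ∎
    where S = ∑[ t < suc n ] f (suc t) * invPS f (n ∸ t)

  geomPS-below : ∀ {m n} → n < m → geomPS m n ≈ 0#
  geomPS-below {n = zero}  _   = refl
  geomPS-below {m} {suc n} n<m =
    reflexive (≡.cong (λ b → if b then 1# else 0#)
                      (dec-false (m ∣? suc n) (λ m∣n → ℕₚ.<⇒≱ n<m (∣⇒≤ m∣n))))

  -- q^m / (1 − q^m) − q^m · q^m / (1 − q^m) = q^m, read off at q^(m + d)
  geomPS-step : ∀ {m} → 1 ≤ m → ∀ d → geomPS m (m ℕ.+ d) - geomPS m d ≈ one d
  geomPS-step {m@(suc _)} _ zero = begin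
    geomPS m (m ℕ.+ 0) - 0#  ≈⟨ +-congˡ -0#≈0# ⟩
    geomPS m (m ℕ.+ 0) + 0#  ≈⟨ +-identityʳ _ ⟩
    geomPS m (m ℕ.+ 0)       ≡⟨ ≡.cong (λ b → if b then 1# else 0#) (dec-true (m ∣? m ℕ.+ 0) m∣m+0) ⟩
    1#                       ∎
    where m∣m+0 = ≡.subst (m ∣_) (≡.sym (ℕₚ.+-identityʳ m)) ∣-refl
  geomPS-step {m@(suc _)} _ (suc t) =
    trans (+-congʳ (reflexive (≡.cong (λ b → if b then 1# else 0#) same-test))) (-‿inverseʳ _)
    where
    same-test : does (m ∣? m ℕ.+ suc t) ≡ does (m ∣? suc t)
    same-test = does-⇔ (mk⇔ (λ m∣ → ∣m+n∣m⇒∣n m∣ ∣-refl) (∣m∣n⇒∣m+n ∣-refl))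
                       (m ∣? m ℕ.+ suc t) (m ∣? suc t)

  oneMinusQPow-geomPS : ∀ {m} → 1 ≤ m → ∀ n → oneMinusQPow m (geomPS m) n ≈ shift m one n
  oneMinusQPow-geomPS {m} 1≤m n with m ℕ.≤? n
  ... | yes m≤n = begin
    geomPS m n - shift m (geomPS m) n             ≡⟨ ≡.cong₂ _-_ (≡.cong (geomPS m) (≡.sym (ℕₚ.m+[n∸m]≡n m≤n)))
                                                                  (shift-≤ (geomPS m) m≤n) ⟩
    geomPS m (m ℕ.+ (n ∸ m)) - geomPS m (n ∸ m)   ≈⟨ geomPS-step 1≤m (n ∸ m) ⟩
    one (n ∸ m)                                   ≡⟨ shift-≤ one m≤n ⟨
    shift m one n                                 ∎
  ... | no m≰n = begin
    geomPS m n - shift m (geomPS m) n             ≈⟨ +-cong (geomPS-below n<m)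
                                                              (-‿cong (reflexive (shift-< (geomPS m) n<m))) ⟩
    0# - 0#                                       ≈⟨ -‿inverseʳ 0# ⟩
    0#                                            ≡⟨ shift-< one n<m ⟨
    shift m one n                                 ∎
    where n<m = ℕₚ.≰⇒> m≰n

  ∑ˡ-sublists-∷ : ∀ e es (g : List ℕ → Carrier) →
                  ∑ˡ (sublists (e ∷ es)) g ≈ (∑[ p ∈ sublists es ] g (e ∷ p)) + ∑ˡ (sublists es) g
  ∑ˡ-sublists-∷ e es g = trans (∑ˡ-++ (map (e ∷_) (sublists es)) (sublists es) g)
                                (+-congʳ (reflexive (∑ˡ-map (e ∷_) (sublists es) g)))

  ∑ˡ-sublists-∷ʳ : ∀ es e (g : List ℕ → Carrier) →
                   ∑ˡ (sublists (es ∷ʳ e)) g ≈ ∑ˡ (sublists es) g + (∑[ p ∈ sublists es ] g (p ∷ʳ e))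
  ∑ˡ-sublists-∷ʳ [] e g = trans (+-comm _ _) (+-congˡ (sym (+-identityʳ _)))
  ∑ˡ-sublists-∷ʳ (y ∷ es) e g = begin
    ∑ˡ (sublists (y ∷ (es ∷ʳ e))) g
      ≈⟨ ∑ˡ-sublists-∷ y (es ∷ʳ e) g ⟩
    (∑[ p ∈ sublists (es ∷ʳ e) ] g (y ∷ p)) + ∑ˡ (sublists (es ∷ʳ e)) g
      ≈⟨ +-cong (∑ˡ-sublists-∷ʳ es e (g ∘ (y ∷_))) (∑ˡ-sublists-∷ʳ es e g) ⟩
    (∑ˡ S (g ∘ (y ∷_)) + ∑ˡ S (g ∘ (_∷ʳ e) ∘ (y ∷_))) + (∑ˡ S g + ∑ˡ S (g ∘ (_∷ʳ e)))
      ≈⟨ interchange _ _ _ _ ⟩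
    (∑ˡ S (g ∘ (y ∷_)) + ∑ˡ S g) + (∑ˡ S (g ∘ (_∷ʳ e) ∘ (y ∷_)) + ∑ˡ S (g ∘ (_∷ʳ e)))
      ≈⟨ +-cong (∑ˡ-sublists-∷ y es g) (∑ˡ-sublists-∷ y es (λ p → g (p ∷ʳ e))) ⟨
    ∑ˡ (sublists (y ∷ es)) g + (∑[ p ∈ sublists (y ∷ es) ] g (p ∷ʳ e))
      ∎
    where S = sublists es

  ∑ˡ-sublists-reverse : ∀ es (g : List ℕ → Carrier) → (∀ {p p′} → p ↭ p′ → g p ≈ g p′) →
                        ∑ˡ (sublists (reverse es)) g ≈ ∑ˡ (sublists es) g
  ∑ˡ-sublists-reverse []       g g-↭ = refl
  ∑ˡ-sublists-reverse (e ∷ es) g g-↭ = begin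
    ∑ˡ (sublists (reverse (e ∷ es))) g
      ≡⟨ ≡.cong (λ xs → ∑ˡ (sublists xs) g) (Listₚ.unfold-reverse e es) ⟩
    ∑ˡ (sublists (reverse es ∷ʳ e)) g
      ≈⟨ ∑ˡ-sublists-∷ʳ (reverse es) e g ⟩
    ∑ˡ (sublists (reverse es)) g + (∑[ p ∈ sublists (reverse es) ] g (p ∷ʳ e))
      ≈⟨ +-congˡ (∑ˡ-cong (sublists (reverse es)) (λ p → g-↭ (↭-sym (∷↭∷ʳ e p)))) ⟩
    ∑ˡ (sublists (reverse es)) g + (∑[ p ∈ sublists (reverse es) ] g (e ∷ p))
      ≈⟨ +-cong (∑ˡ-sublists-reverse es g g-↭) (∑ˡ-sublists-reverse es (g ∘ (e ∷_)) (g-↭ ∘ ↭.prep e)) ⟩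
    ∑ˡ (sublists es) g + (∑[ p ∈ sublists es ] g (e ∷ p))
      ≈⟨ +-comm _ _ ⟩
    (∑[ p ∈ sublists es ] g (e ∷ p)) + ∑ˡ (sublists es) g
      ≈⟨ ∑ˡ-sublists-∷ e es g ⟨
    ∑ˡ (sublists (e ∷ es)) g
      ∎

  subsetSeries : List ℕ → (List ℕ → Carrier) → PS
  subsetSeries es w n = ∑[ p ∈ sublists es ] monomial (sum p) (w p) n

  subsetSeries-cong : ∀ es {w w′ : List ℕ → Carrier} n → (∀ p → w p ≈ w′ p) →
                      subsetSeries es w n ≈ subsetSeries es w′ n
  subsetSeries-cong es n w≈w′ = ∑ˡ-cong (sublists es) (λ p → monomial-cong (sum p) n (w≈w′ p))

  subsetSeries-neg : ∀ es w n → subsetSeries es (λ p → - w p) n ≈ - subsetSeries es w n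
  subsetSeries-neg es w n =
    trans (∑ˡ-cong (sublists es) (λ p → monomial-neg (sum p) (w p) n)) (sym (∑ˡ-neg (sublists es) _))

  subsetSeries-reverse : ∀ es w n → (∀ {p p′} → p ↭ p′ → w p ≈ w p′) →
                         subsetSeries (reverse es) w n ≈ subsetSeries es w n
  subsetSeries-reverse es w n w-↭ = ∑ˡ-sublists-reverse es _ (λ {p} {p′} p↭p′ →
    trans (reflexive (≡.cong (λ s → monomial s (w p) n) (sum-↭ p↭p′))) (monomial-cong (sum p′) n (w-↭ p↭p′)))

  subsetSeries-∷ : ∀ e es w n →
                   subsetSeries (e ∷ es) w n ≈ shift e (subsetSeries es (w ∘ (e ∷_))) n + subsetSeries es w n
  subsetSeries-∷ e es w n = begin
    subsetSeries (e ∷ es) w n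
      ≈⟨ ∑ˡ-sublists-∷ e es (λ p → monomial (sum p) (w p) n) ⟩
    (∑[ p ∈ sublists es ] monomial (e ℕ.+ sum p) (w (e ∷ p)) n) + subsetSeries es w n
      ≈⟨ +-congʳ (∑ˡ-cong (sublists es) (λ p → monomial-shift e (sum p) (w (e ∷ p)) n)) ⟩
    (∑[ p ∈ sublists es ] shift e (monomial (sum p) (w (e ∷ p))) n) + subsetSeries es w n
      ≈⟨ +-congʳ (∑ˡ-shift (sublists es) e (λ p → monomial (sum p) (w (e ∷ p))) n) ⟩
    shift e (subsetSeries es (w ∘ (e ∷_))) n + subsetSeries es w n
      ∎

  subsetSeries-∷-alternating : ∀ e es w n → (∀ p → w (e ∷ p) ≈ - w p) →
                               subsetSeries (e ∷ es) w n ≈ oneMinusQPow e (subsetSeries es w) n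
  subsetSeries-∷-alternating e es w n w-flip = begin
    subsetSeries (e ∷ es) w n                     ≈⟨ subsetSeries-∷ e es w n ⟩
    shift e (subsetSeries es (w ∘ (e ∷_))) n + S n ≈⟨ +-congʳ (shift-cong e n (λ i →
                                                         trans (subsetSeries-cong es i w-flip) (subsetSeries-neg es w i))) ⟩
    shift e (λ i → - S i) n + S n                 ≈⟨ +-congʳ (shift-neg e S n) ⟩
    - shift e S n + S n                           ≈⟨ +-comm _ _ ⟩
    S n - shift e S n                             ∎
    where S = subsetSeries es w

  sign : ℕ → Carrier
  sign l = if isOdd l then - 1# else 1#

  sign-suc : ∀ l → sign (suc l) ≈ - sign l
  sign-suc l rewrite isOdd-suc l with isOdd l
  ... | true  = sym (-‿involutive _)
  ... | false = refl

  prodOneMinusQPow : List ℕ → PS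
  prodOneMinusQPow = foldr oneMinusQPow one

  prodOneMinusQPow-expansion : ∀ es n → prodOneMinusQPow es n ≈ subsetSeries es (sign ∘ length) n
  prodOneMinusQPow-expansion []       n = sym (+-identityʳ _)
  prodOneMinusQPow-expansion (e ∷ es) n =
    trans (oneMinusQPow-cong e n (prodOneMinusQPow-expansion es))
          (sym (subsetSeries-∷-alternating e es _ n (λ p → sign-suc (length p))))

  signedOcc : ℕ → List ℕ → Carrier
  signedOcc m p = - (sign (length p) * fromℕ (occ m p))

  signedOcc-↭ : ∀ m {p p′} → p ↭ p′ → signedOcc m p ≈ signedOcc m p′
  signedOcc-↭ m p↭p′ =
    -‿cong (*-cong (reflexive (≡.cong sign (↭-length p↭p′))) (reflexive (≡.cong fromℕ (occ-↭ m p↭p′))))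

  signedOcc-∷-≢ : ∀ {m e} → m ≢ e → ∀ p → signedOcc m (e ∷ p) ≈ - signedOcc m p
  signedOcc-∷-≢ {m} m≢e p = begin
    - (sign (suc (length p)) * fromℕ (occ m (_ ∷ p)))   ≈⟨ -‿cong (*-cong (sign-suc (length p))
                                                              (reflexive (≡.cong fromℕ (occ-∷-≢ m≢e p)))) ⟩
    - (- sign (length p) * fromℕ (occ m p))              ≈⟨ -‿cong (-‿distribˡ-* _ _) ⟨
    - - (sign (length p) * fromℕ (occ m p))              ∎

  signedOcc-∷-≡ : ∀ m {p} → occ m p ≡ 0 → signedOcc m (m ∷ p) ≈ sign (length p)
  signedOcc-∷-≡ m {p} m∉p = begin
    - (sign (suc (length p)) * fromℕ (occ m (m ∷ p)))   ≈⟨ -‿cong (*-cong (sign-suc (length p)) (reflexive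
                                                              (≡.cong fromℕ (≡.trans (occ-∷-≡ m p) (≡.cong suc m∉p))))) ⟩
    - (- sign (length p) * (1# + 0#))                    ≈⟨ -‿cong (*-congˡ (+-identityʳ 1#)) ⟩
    - (- sign (length p) * 1#)                           ≈⟨ -‿cong (*-identityʳ _) ⟩
    - - sign (length p)                                  ≈⟨ -‿involutive _ ⟩
    sign (length p)                                      ∎

  signedOcc-absent : ∀ m {p} → occ m p ≡ 0 → signedOcc m p ≈ 0#
  signedOcc-absent m m∉p = trans (-‿cong (trans (*-congˡ (reflexive (≡.cong fromℕ m∉p))) (zeroʳ _))) -0#≈0#

  subsetSeries-cong-avoiding : ∀ m es {w w′ : List ℕ → Carrier} n → occ m es ≡ 0 →
    (∀ {p} → occ m p ≡ 0 → w p ≈ w′ p) → subsetSeries es w n ≈ subsetSeries es w′ n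
  subsetSeries-cong-avoiding m es n m∉ w≈w′ =
    ∑ˡ-cong-All (All.map (λ {p} m∉p → monomial-cong (sum p) n (w≈w′ m∉p)) (sublists-avoid es m∉))

  subsetSeries-signedOcc-head : ∀ m es n → occ m es ≡ 0 →
    subsetSeries (m ∷ es) (signedOcc m) n ≈ shift m (subsetSeries es (sign ∘ length)) n
  subsetSeries-signedOcc-head m es n m∉ = begin
    subsetSeries (m ∷ es) (signedOcc m) n
      ≈⟨ subsetSeries-∷ m es (signedOcc m) n ⟩
    shift m (subsetSeries es (signedOcc m ∘ (m ∷_))) n + subsetSeries es (signedOcc m) n
      ≈⟨ +-cong (shift-cong m n (λ i → subsetSeries-cong-avoiding m es i m∉ (λ {p} → signedOcc-∷-≡ m {p})))
                (subsetSeries-cong-avoiding m es n m∉ (λ {p} → signedOcc-absent m {p})) ⟩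
    shift m (subsetSeries es (sign ∘ length)) n + subsetSeries es (λ _ → 0#) n
      ≈⟨ +-congˡ (trans (∑ˡ-cong (sublists es) (λ p → monomial-zero (sum p) n refl)) (∑ˡ-0# (sublists es))) ⟩
    shift m (subsetSeries es (sign ∘ length)) n + 0#
      ≈⟨ +-identityʳ _ ⟩
    shift m (subsetSeries es (sign ∘ length)) n
      ∎

  prodOneMinusQPow⋆geomPS : ∀ {m} es → 1 ≤ m → occ m es ≡ 1 → ∀ n →
    (prodOneMinusQPow es ⋆ geomPS m) n ≈ subsetSeries es (signedOcc m) n
  prodOneMinusQPow⋆geomPS {m} (e ∷ es) 1≤m once n with m ℕ.≟ e
  ... | no m≢e = begin
    (oneMinusQPow e P ⋆ G) n                          ≈⟨ ⋆-oneMinusQPowˡ e P G n ⟩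
    oneMinusQPow e (P ⋆ G) n                          ≈⟨ oneMinusQPow-cong e n (prodOneMinusQPow⋆geomPS es 1≤m once′) ⟩
    oneMinusQPow e (subsetSeries es (signedOcc m)) n  ≈⟨ subsetSeries-∷-alternating e es _ n (signedOcc-∷-≢ m≢e) ⟨
    subsetSeries (e ∷ es) (signedOcc m) n             ∎
    where
    P = prodOneMinusQPow es
    G = geomPS m
    once′ = ≡.trans (≡.sym (occ-∷-≢ m≢e es)) once
  ... | yes ≡.refl = begin
    (oneMinusQPow m P ⋆ G) n                          ≈⟨ ⋆-oneMinusQPowˡ m P G n ⟩
    oneMinusQPow m (P ⋆ G) n                          ≈⟨ oneMinusQPow-cong m n (⋆-comm P G) ⟩
    oneMinusQPow m (G ⋆ P) n                          ≈⟨ ⋆-oneMinusQPowˡ m G P n ⟨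
    (oneMinusQPow m G ⋆ P) n                          ≈⟨ ⋆-congˡ P n (λ i _ → oneMinusQPow-geomPS 1≤m i) ⟩
    (shift m one ⋆ P) n                               ≈⟨ ⋆-shiftˡ m one P n ⟩
    shift m (one ⋆ P) n                               ≈⟨ shift-cong m n (λ i → trans (⋆-identityˡ P i)
                                                                               (prodOneMinusQPow-expansion es i)) ⟩
    shift m (subsetSeries es (sign ∘ length)) n       ≈⟨ subsetSeries-signedOcc-head m es n m∉ ⟨
    subsetSeries (m ∷ es) (signedOcc m) n             ∎
    where
    P = prodOneMinusQPow es
    G = geomPS m
    m∉ = ℕₚ.suc-injective (≡.trans (≡.sym (occ-∷-≡ m es)) once)

  parity-split : ∀ b v → (if does (b Bool.≟ true) then v else 0#) - (if does (b Bool.≟ false) then v else 0#)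
                         ≈ - ((if b then - 1# else 1#) * v)
  parity-split true  v = begin
    v - 0#        ≈⟨ +-congˡ -0#≈0# ⟩
    v + 0#        ≈⟨ +-identityʳ v ⟩
    v             ≈⟨ -‿involutive v ⟨
    - - v         ≈⟨ -‿cong (-1*x≈-x v) ⟨
    - (- 1# * v)  ∎
  parity-split false v = trans (+-identityˡ _) (-‿cong (sym (*-identityˡ v)))

  module _ {α β : ℕ} (β<α : β < α) where

    oddMinusEven : ℕ → ℕ → Carrier
    oddMinusEven n k = fromℕ (s-o α β n k) - fromℕ (s-e α β n k)

    finProd≈prodOneMinusQPow : ∀ M n → finProd α β M n ≈ prodOneMinusQPow (parts α β M) n
    finProd≈prodOneMinusQPow zero    zero    = refl
    finProd≈prodOneMinusQPow zero    (suc n) = refl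
    finProd≈prodOneMinusQPow (suc M) n = oneMinusQPow-cong (part α β (suc M)) n (finProd≈prodOneMinusQPow M)

    qPochhammer≈finProd : ∀ {n M} → n ≤ M → qPochhammer α β n ≈ finProd α β M n
    qPochhammer≈finProd {M = zero}  z≤n = refl
    qPochhammer≈finProd {n} {suc M} n≤M with ℕₚ.m≤n⇒m<n∨m≡n n≤M
    ... | inj₂ ≡.refl = refl
    ... | inj₁ n<M    = trans (qPochhammer≈finProd (ℕₚ.≤-pred n<M)) (sym (oneMinusQPow-below
                                (part α β (suc M)) (finProd α β M) (ℕₚ.<-≤-trans n<M (j≤part β<α (suc M)))))

    lhsPS≈∑ : ∀ a {n M} → n ≤ M → lhsPS α β a n ≈ ∑[ j < M ] a (suc j) * geomPS (part α β (suc j)) n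
    lhsPS≈∑ a {n} {M} n≤M = begin
      lhsPS α β a n                            ≈⟨ sumFromTo-1 n (λ j → a j * geomPS (part α β j) n) ⟩
      ∑[ j < n ] term j                        ≈⟨ ∑-pad n (M ∸ n) term vanish ⟨
      ∑[ j < n ℕ.+ (M ∸ n) ] term j            ≡⟨ ≡.cong (λ k → ∑ k term) (ℕₚ.m+[n∸m]≡n n≤M) ⟩
      ∑[ j < M ] term j                        ∎
      where
      term : ℕ → Carrier
      term j = a (suc j) * geomPS (part α β (suc j)) n
      vanish : ∀ j → n ≤ j → term j ≈ 0#
      vanish j n≤j = trans (*-congˡ (geomPS-below (ℕₚ.<-≤-trans (s≤s n≤j) (j≤part β<α (suc j))))) (zeroʳ _)

    oddMinusEven≈subsetSeries : ∀ n k →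
      oddMinusEven n k ≈ subsetSeries (map (part α β) (range1 n)) (signedOcc (part α β k)) n
    oddMinusEven≈subsetSeries n k = begin
      fromℕ (s-o α β n k) - fromℕ (s-e α β n k)
        ≈⟨ +-cong (count true) (-‿cong (count false)) ⟩
      ∑ˡ DP (parity true) - ∑ˡ DP (parity false)
        ≈⟨ +-congˡ (∑ˡ-neg DP (parity false)) ⟩
      ∑ˡ DP (parity true) + (∑[ p ∈ DP ] - parity false p)
        ≈⟨ ∑ˡ-+ DP (parity true) (λ p → - parity false p) ⟨
      ∑[ p ∈ DP ] (parity true p - parity false p)
        ≈⟨ ∑ˡ-cong DP (λ p → parity-split (isOdd (length p)) (fromℕ (occ m p))) ⟩
      ∑ˡ DP (signedOcc m)
        ≈⟨ ∑ˡ-filter (λ p → sum p ℕ.≟ n) (map (map (part α β)) (sublists (range1 n))) (signedOcc m) ⟩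
      ∑[ p ∈ map (map (part α β)) (sublists (range1 n)) ] monomial (sum p) (signedOcc m p) n
        ≡⟨ ≡.cong (λ ps → ∑[ p ∈ ps ] monomial (sum p) (signedOcc m p) n)
                  (sublists-map (part α β) (range1 n)) ⟨
      subsetSeries (map (part α β) (range1 n)) (signedOcc m) n
        ∎
      where
      m  = part α β k
      DP = distinctPartitions α β n
      parity : Bool → List ℕ → Carrier
      parity b p = if does (isOdd (length p) Bool.≟ b) then fromℕ (occ m p) else 0#
      hasParity : ∀ b p → Dec (isOdd (length p) ≡ b)
      hasParity b p = isOdd (length p) Bool.≟ b
      count : ∀ b → fromℕ (sum (map (occ m) (filter (hasParity b) DP))) ≈ ∑ˡ DP (parity b)
      count b = trans (fromℕ-sum (occ m) (filter (hasParity b) DP)) (∑ˡ-filter (hasParity b) DP (fromℕ ∘ occ m))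

    oddMinusEven≈finProd⋆geomPS : ∀ {n k} → 1 ≤ k → k ≤ n →
                                  oddMinusEven n k ≈ (finProd α β n ⋆ geomPS (part α β k)) n
    oddMinusEven≈finProd⋆geomPS {n} {k} 1≤k k≤n = begin
      oddMinusEven n k                                ≈⟨ oddMinusEven≈subsetSeries n k ⟩
      subsetSeries (map (part α β) (range1 n)) w n    ≡⟨ ≡.cong (λ es → subsetSeries es w n) (map-part-range1 α β n) ⟩
      subsetSeries (reverse (parts α β n)) w n        ≈⟨ subsetSeries-reverse (parts α β n) w n (signedOcc-↭ m) ⟩
      subsetSeries (parts α β n) w n                  ≈⟨ prodOneMinusQPow⋆geomPS (parts α β n) 1≤m
                                                           (occ-parts-once β<α n 1≤k k≤n) n ⟨
      (prodOneMinusQPow (parts α β n) ⋆ geomPS m) n   ≈⟨ ⋆-congˡ (geomPS m) n (λ i _ → finProd≈prodOneMinusQPow n i) ⟨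
      (finProd α β n ⋆ geomPS m) n                    ∎
      where
      m = part α β k
      w = signedOcc m
      1≤m = ℕₚ.≤-trans 1≤k (j≤part β<α k)

    rhsSeries≈∑ : ∀ a n → rhsSeries α β a n ≈ ∑[ j < n ] oddMinusEven n (suc j) * a (suc j)
    rhsSeries≈∑ a zero    = refl
    rhsSeries≈∑ a (suc n) = sumFromTo-1 (suc n) _

    rhsSeries≈qPochhammer⋆lhsPS : ∀ a n → rhsSeries α β a n ≈ (qPochhammer α β ⋆ lhsPS α β a) n
    rhsSeries≈qPochhammer⋆lhsPS a n = begin
      rhsSeries α β a n
        ≈⟨ rhsSeries≈∑ a n ⟩
      ∑[ j < n ] oddMinusEven n (suc j) * a (suc j)
        ≈⟨ ∑-cong n (λ j j<n → trans (*-congʳ (oddMinusEven≈finProd⋆geomPS z<s j<n)) (*-comm _ _)) ⟩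
      ∑[ j < n ] a (suc j) * (P ⋆ G j) n
        ≈⟨ ⋆-∑ʳ n P (a ∘ suc) G n ⟨
      (P ⋆ (λ i → ∑[ j < n ] a (suc j) * G j i)) n
        ≈⟨ ⋆-congʳ P n (λ i i≤n → lhsPS≈∑ a i≤n) ⟨
      (P ⋆ lhsPS α β a) n
        ≈⟨ ⋆-congˡ (lhsPS α β a) n (λ i i≤n → qPochhammer≈finProd i≤n) ⟨
      (qPochhammer α β ⋆ lhsPS α β a) n
        ∎
      where
      P = finProd α β n
      G : ℕ → PS
      G j = geomPS (part α β (suc j))

proposition2p2 : ∀ {c ℓ} (R : CommutativeRing c ℓ) (α β : ℕ) → 1 ≤ α → β < α →
    (a : ℕ → CommutativeRing.Carrier R) → (N : ℕ) →
    CommutativeRing._≈_ R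
    (Series.lhsPS R α β a N)
    (Series.mulPS R (Series.invPS R (Series.qPochhammer R α β)) (Series.rhsSeries R α β a) N)
-- `1 ≤ α` is implied by `β < α`.
proposition2p2 R α β _ β<α a N = begin
  L N                                ≈⟨ ⋆-identityˡ L N ⟨
  (one ⋆ L) N                        ≈⟨ ⋆-congˡ L N (λ i _ → trans (⋆-comm (invPS Q) Q i) (⋆-invPSʳ Q refl i)) ⟨
  (invPS Q ⋆ Q ⋆ L) N                ≈⟨ ⋆-assoc (invPS Q) Q L N ⟩
  (invPS Q ⋆ (Q ⋆ L)) N              ≈⟨ ⋆-congʳ (invPS Q) N (λ i _ → rhsSeries≈qPochhammer⋆lhsPS β<α a i) ⟨
  (invPS Q ⋆ rhsSeries α β a) N      ≈⟨ mulPS≈⋆ (invPS Q) (rhsSeries α β a) N ⟨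
  mulPS (invPS Q) (rhsSeries α β a) N ∎
  where
  open CommutativeRing R
  open Series R
  open PowerSeries R
  open SetoidReasoning setoid
  Q = qPochhammer α β
  L = lhsPS α β a
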